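{- Let $G$ be an oriented hypergraph in which every adjacency is negative, and let $\mathbf u=(u_1,\dots,u_k)$, $\mathbf w=(w_1,\dots,w_k)$ be sequences of vertices. Then \[\sum_{c\in\widehat{\mathfrak{C}}_{\neq0}(L^0(G);\mathbf u,\mathbf w)}\mathrm{sgn}_P(c)=(-1)^{|V|-k}\,\big|\widehat{\mathfrak{C}}_{\neq0}(L^0(G);\mathbf u,\mathbf w)\big|.\]
   Context: An oriented hypergraph $G$ consists of finite sets $V$ (vertices), $E$ (edges), $I$ (incidences), maps $\varsigma:I\to V$, $\omega:I\to E$ and an orientation $\sigma:I\to\{+1,-1\}$. An adjacency is an ordered pair $(i,j)$ of distinct incidences with $\omega(i)=\omega(j)$, going from $\varsigma(i)$ to $\varsigma(j)$, with sign $-\sigma(i)\sigma(j)$; a backstep at $v$ is the step $v,i,\omega(i),i,v$ with $\varsigma(i)=v$. With $U=\{u_1,\dots,u_k\}$, $\widehat{\mathfrak{C}}_{\neq0}(L^0(G);\mathbf u,\mathbf w)$ is the set of assignments $c$ choosing, for each $v\in V\setminus U$, an adjacency of $G$ starting at $v$ or a backstep at $v$, such that the rule $\pi_c(v)=$ head of the step at $v$ for $v\notin U$, $\pi_c(u_i)=w_i$, defines a bijection $\pi_c:V\to V$ (these are the contributors of the zero-loading $L^0(G)$ with $u_i\mapsto w_i$, with those maps removed, whose remaining steps lie in $G$). $bs(c)$ is the number of backsteps of $c$; $nc(c)$ is the number of components of $c$ (connected components of the graph on $V$ formed by the steps of $c$) whose product of adjacency signs is $-1$. The permanental sign is $\mathrm{sgn}_P(c)=(-1)^{nc(c)+bs(c)}$.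 -}

module Defs where

open import Data.Nat using (ℕ; zero; suc; _∸_)
open import Data.Bool using (Bool; true; false; _∧_; _∨_; not; if_then_else_)
open import Data.Fin using (Fin; toℕ; _≟_)
open import Data.Nat using (_<ᵇ_)
open import Data.Maybe using (Maybe; just; nothing)
open import Data.Product using (_×_; _,_)
open import Data.List using (List; []; _∷_; map; filter; length; allFin; cartesianProduct; foldr; findᵇ)
open import Data.Bool.ListAction using (all; any)
open import Data.Vec using (Vec; lookup)
import Data.Vec as Vec
open import Data.Sign using (Sign) renaming (_*_ to _*ˢ_)
import Data.Sign as Sign
open import Data.Integer using (ℤ; -1ℤ; 0ℤ; _^_) renaming (_+_ to _+ℤ_)
open import Relation.Nullary.Decidable using (⌊_⌋)
open import Relation.Binary.PropositionalEquality using (_≡_; _≢_)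

record OrientedHypergraph : Set where
  field
    nV nE nI : ℕ
    ς : Fin nI → Fin nV
    ω : Fin nI → Fin nE
    σ : Fin nI → Sign

open OrientedHypergraph public

adjSign : (G : OrientedHypergraph) → Fin (nI G) → Fin (nI G) → Sign
adjSign G i j = Sign.opposite (σ G i *ˢ σ G j)

AllAdjacenciesNegative : OrientedHypergraph → Set
AllAdjacenciesNegative G =
  ∀ (i j : Fin (nI G)) → i ≢ j → ω G i ≡ ω G j → adjSign G i j ≡ Sign.-

_=ᶠ_ : ∀ {n} → Fin n → Fin n → Bool
x =ᶠ y = ⌊ x ≟ y ⌋

allᶠ : ∀ {n} → (Fin n → Bool) → Bool
allᶠ {n} p = all p (allFin n)

anyᶠ : ∀ {n} → (Fin n → Bool) → Bool
anyᶠ {n} p = any p (allFin n)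

countᶠ : ∀ {n} → (Fin n → Bool) → ℕ
countᶠ {n} p = length (filter (λ x → Data.Bool.T? (p x)) (allFin n))

allVecs : ∀ {A : Set} → List A → (n : ℕ) → List (Vec A n)
allVecs xs zero    = Vec.[] ∷ []
allVecs xs (suc n) =
  foldr (λ x acc → map (x Vec.∷_) (allVecs xs n) Data.List.++ acc) [] xs

-- A step at v is a pair (i , j) of incidences with ς(i) = v and
-- ω(i) = ω(j).  If i ≠ j it is the adjacency (i , j); if i = j it is the
-- backstep v,i,ω(i),i,v.  Its head is ς(j).
-- An assignment c gives, for every vertex v, either nothing (intended
-- exactly for v ∈ U) or a step at v.

module _ (G : OrientedHypergraph) {k : ℕ} (u w : Fin k → Fin (nV G)) where

  Step : Set
  Step = Fin (nI G) × Fin (nI G)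

  Assignment : Set
  Assignment = Vec (Maybe Step) (nV G)

  indexInU : Fin (nV G) → Maybe (Fin k)
  indexInU v = findᵇ (λ i → u i =ᶠ v) (allFin k)

  π : Assignment → Fin (nV G) → Fin (nV G)
  π c v with indexInU v
  ... | just i  = w i
  ... | nothing with lookup c v
  ...   | just (i , j) = ς G j
  ...   | nothing      = v

  stepsOK : Assignment → Bool
  stepsOK c = allᶠ λ v → check v (indexInU v) (lookup c v)
    where
    check : Fin (nV G) → Maybe (Fin k) → Maybe Step → Bool
    check v (just _) nothing        = true
    check v (just _) (just _)       = false
    check v nothing  nothing        = false
    check v nothing  (just (i , j)) = (ς G i =ᶠ v) ∧ (ω G i =ᶠ ω G j)

  isBijection : (Fin (nV G) → Fin (nV G)) → Bool
  isBijection f =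
    (allᶠ λ x → allᶠ λ y → not (f x =ᶠ f y) ∨ (x =ᶠ y))
    ∧ (allᶠ λ y → anyᶠ λ x → f x =ᶠ y)

  isContributor : Assignment → Bool
  isContributor c = stepsOK c ∧ isBijection (π c)

  -- the set  Ĉ_{≠0}(L⁰(G); u, w)  as a (duplicate-free) list
  contributors : List Assignment
  contributors =
    filter (λ c → Data.Bool.T? (isContributor c))
      (allVecs (nothing ∷ map just (cartesianProduct (allFin (nI G)) (allFin (nI G))))
               (nV G))

  stepEdge : Assignment → Fin (nV G) → Fin (nV G) → Bool
  stepEdge c x y with lookup c x
  ... | just (i , j) = ς G j =ᶠ y
  ... | nothing      = false

  linked : Assignment → Fin (nV G) → Fin (nV G) → Bool
  linked c x y = stepEdge c x y ∨ stepEdge c y x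

  walk : Assignment → ℕ → Fin (nV G) → Fin (nV G) → Bool
  walk c zero    x y = x =ᶠ y
  walk c (suc t) x y = (x =ᶠ y) ∨ anyᶠ (λ z → linked c x z ∧ walk c t z y)

  -- same connected component (a graph on |V| vertices: walks of length ≤ |V|)
  connected : Assignment → Fin (nV G) → Fin (nV G) → Bool
  connected c = walk c (nV G)

  isRepresentative : Assignment → Fin (nV G) → Bool
  isRepresentative c v = allᶠ λ x → not ((toℕ x <ᵇ toℕ v) ∧ connected c x v)

  stepSign : Assignment → Fin (nV G) → Sign
  stepSign c x with lookup c x
  ... | just (i , j) = if i =ᶠ j then Sign.+ else adjSign G i j
  ... | nothing      = Sign.+

  componentSign : Assignment → Fin (nV G) → Sign
  componentSign c v =
    foldr _*ˢ_ Sign.+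
      (map (stepSign c) (filter (λ x → Data.Bool.T? (connected c v x)) (allFin (nV G))))

  isNegativeSign : Sign → Bool
  isNegativeSign Sign.- = true
  isNegativeSign Sign.+ = false

  nc : Assignment → ℕ
  nc c = countᶠ λ v → isRepresentative c v ∧ isNegativeSign (componentSign c v)

  bs : Assignment → ℕ
  bs c = countᶠ λ x → isBackstep (lookup c x)
    where
    isBackstep : Maybe Step → Bool
    isBackstep (just (i , j)) = i =ᶠ j
    isBackstep nothing        = false

  sgnP : Assignment → ℤ
  sgnP c = -1ℤ ^ (nc c Data.Nat.+ bs c)

sumℤ : List ℤ → ℤ
sumℤ = foldr _+ℤ_ 0ℤ

module Submission where

-- For a contributor c, the components of c partition V, so (-1)^nc(c) is the product of the
-- signs of all steps of c.  Multiplying in (-1)^bs(c) attaches to every vertex outside U the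
-- factor -1: a backstep counts -1 in bs and + in the product, an adjacency counts -1 in the
-- product because every adjacency is negative.  The vertices of U carry no step, and u is
-- injective, so sgn_P(c) = (-1)^(|V| - k) for every contributor.

open import Defs
open import Data.Nat using (ℕ; _∸_)
open import Data.Fin using (Fin)
open import Data.List using (map; length)
open import Data.Integer using (ℤ; -1ℤ; +_; _*_; _^_)
open import Function.Definitions using (Injective)
open import Relation.Binary.PropositionalEquality using (_≡_)

open import Algebra.Bundles using (CommutativeMonoid)
open import Data.Bool using (Bool; true; false; T; not; _∧_; _∨_; if_then_else_)
open import Data.Bool.ListAction using (any; or)
open import Data.Bool.Properties using (T-∧; T-∨; T-≡; ∨-comm)
open import Data.Empty using (⊥-elim)
open import Data.Fin using (toℕ; _≟_)
import Data.Fin.Properties as FP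
open import Data.Integer using (_◃_) renaming (_+_ to _+ℤ_)
import Data.Integer.Properties as ℤP
open import Data.List using (List; []; _∷_; filter; foldr; findᵇ; allFin; cartesianProduct)
import Data.List.Properties as LP
open import Data.List.Membership.Propositional using (_∈_; lose)
open import Data.List.Membership.Propositional.Properties using (∈-allFin)
open import Data.List.Relation.Unary.All using (All; []; _∷_)
import Data.List.Relation.Unary.All as All
open import Data.List.Relation.Unary.All.Properties using (all⁺; all⁻; tabulate⁺; all-filter)
open import Data.List.Relation.Unary.AllPairs using ([]; _∷_)
open import Data.List.Relation.Unary.Any using (here; there; satisfied)
open import Data.List.Relation.Unary.Any.Properties using (any⁺; any⁻)
open import Data.List.Relation.Unary.Unique.Propositional using (Unique)
open import Data.List.Relation.Unary.Unique.Propositional.Properties using (allFin⁺)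
open import Data.Maybe using (just; nothing; is-just)
open import Data.Nat using (zero; suc; _+_; _≤_; _<_; _<ᵇ_; z≤n; s≤s)
import Data.Nat.Properties as ℕP
open import Data.Product using (Σ; ∃; _,_; proj₁; proj₂)
open import Data.Sign using (Sign) renaming (_*_ to _*ˢ_)
import Data.Sign as S
import Data.Sign.Properties as SP
open import Data.Sum using (_⊎_; inj₁; inj₂)
import Data.Vec as Vec
open import Function.Bundles using (Equivalence)
open Equivalence using (to; from)
open import Relation.Binary.Definitions using (tri<; tri≈; tri>)
open import Relation.Binary.PropositionalEquality
  using (refl; sym; trans; cong; cong₂; subst; module ≡-Reasoning)
open import Relation.Binary.Structures using (IsEquivalence)
open import Relation.Nullary using (¬_; yes; no)
open import Relation.Nullary.Decidable using (T?; toWitness; fromWitness; _×-dec_; ¬?)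

=ᶠ⇒≡ : ∀ {n} {x y : Fin n} → T (x =ᶠ y) → x ≡ y
=ᶠ⇒≡ {x = x} {y} = toWitness {a? = x ≟ y}

=ᶠ-refl : ∀ {n} (x : Fin n) → T (x =ᶠ x)
=ᶠ-refl x = fromWitness {a? = x ≟ x} refl

T-not⇒¬T : ∀ {b} → T (not b) → ¬ T b
T-not⇒¬T {true} () _

¬T-not⇒T : ∀ b → ¬ T (not b) → T b
¬T-not⇒T true  _ = _
¬T-not⇒T false h = h _

allᶠ⇒∀ : ∀ {n} {p : Fin n → Bool} → T (allᶠ p) → ∀ x → T (p x)
allᶠ⇒∀ {n} {p} h x = All.lookup (all⁺ p (allFin n) h) (∈-allFin x)

¬allᶠ⇒∃ : ∀ {n} {p : Fin n → Bool} → ¬ T (allᶠ p) → ∃ λ x → ¬ T (p x)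
¬allᶠ⇒∃ {n} {p} h =
  FP.¬∀⟶∃¬ n (λ x → T (p x)) (λ x → T? (p x)) λ ∀p → h (all⁻ p (tabulate⁺ ∀p))

∃⇒anyᶠ : ∀ {n} {p : Fin n → Bool} {x} → T (p x) → T (anyᶠ p)
∃⇒anyᶠ {p = p} px = any⁺ p (lose (∈-allFin _) px)

anyᶠ⇒∃ : ∀ {n} {p : Fin n → Bool} → T (anyᶠ p) → ∃ λ x → T (p x)
anyᶠ⇒∃ {n} {p} h = satisfied (any⁻ p (allFin n) h)

is-just-findᵇ : ∀ {A : Set} (p : A → Bool) xs → is-just (findᵇ p xs) ≡ any p xs
is-just-findᵇ p [] = refl
is-just-findᵇ p (x ∷ xs) with p x
... | true  = refl
... | false = is-just-findᵇ p xs

length-allFin : ∀ n → length (allFin n) ≡ n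
length-allFin n = LP.length-tabulate (λ x → x)

count : {A : Set} → (A → Bool) → List A → ℕ
count p xs = length (filter (λ x → T? (p x)) xs)

module _ {A : Set} where

  count-pos : ∀ (p : A → Bool) {x xs} → x ∈ xs → T (p x) → 0 < count p xs
  count-pos p {xs = y ∷ _} (here refl) px with p y
  ... | true = s≤s z≤n
  count-pos p {xs = y ∷ _} (there x∈xs) px with p y
  ... | true  = s≤s z≤n
  ... | false = count-pos p x∈xs px

  module _ {p q : A → Bool} (p⇒q : ∀ {x} → T (p x) → T (q x)) where

    count-mono : ∀ xs → count p xs ≤ count q xs
    count-mono [] = z≤n
    count-mono (x ∷ xs) with p x in px | q x in qx
    ... | true  | true  = s≤s (count-mono xs)
    ... | true  | false = ⊥-elim (subst T qx (p⇒q (from T-≡ px)))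
    ... | false | true  = ℕP.m≤n⇒m≤1+n (count-mono xs)
    ... | false | false = count-mono xs

    count-mono-< : ∀ {x xs} → x ∈ xs → T (q x) → ¬ T (p x) → count p xs < count q xs
    count-mono-< {xs = y ∷ xs} (here refl) qy ¬py with p y | q y
    ... | true  | _    = ⊥-elim (¬py _)
    ... | false | true = s≤s (count-mono xs)
    count-mono-< {xs = y ∷ xs} (there x∈xs) qx ¬px with p y in py | q y in qy
    ... | true  | true  = s≤s (count-mono-< x∈xs qx ¬px)
    ... | true  | false = ⊥-elim (subst T qy (p⇒q (from T-≡ py)))
    ... | false | true  = ℕP.m≤n⇒m≤1+n (count-mono-< x∈xs qx ¬px)
    ... | false | false = count-mono-< x∈xs qx ¬px

module ListProduct {c ℓ} (M : CommutativeMonoid c ℓ) where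

  open CommutativeMonoid M
    using ( Carrier; _≈_; _∙_; ε; ∙-congˡ; ∙-cong; identityˡ; identityʳ
          ; setoid; monoid; commutativeSemigroup)
    renaming (refl to ≈-refl; sym to ≈-sym; trans to ≈-trans; reflexive to ≈-reflexive)
  open import Algebra.Properties.CommutativeSemigroup commutativeSemigroup using (interchange)
  open import Algebra.Properties.Monoid.Mult monoid public using (_×_; ×-homo-+)
  open import Relation.Binary.Reasoning.Setoid setoid

  ∏ : {A : Set} → (A → Carrier) → List A → Carrier
  ∏ f xs = foldr _∙_ ε (map f xs)

  module _ {A : Set} where

    ∏-cong : {f g : A → Carrier} → (∀ x → f x ≈ g x) → ∀ xs → ∏ f xs ≈ ∏ g xs
    ∏-cong f≈g []       = ≈-refl
    ∏-cong f≈g (x ∷ xs) = ∙-cong (f≈g x) (∏-cong f≈g xs)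

    ∏-ε : (xs : List A) → ∏ (λ _ → ε) xs ≈ ε
    ∏-ε []       = ≈-refl
    ∏-ε (x ∷ xs) = ≈-trans (identityˡ _) (∏-ε xs)

    ∏-distrib : (f g : A → Carrier) (xs : List A) → ∏ (λ x → f x ∙ g x) xs ≈ ∏ f xs ∙ ∏ g xs
    ∏-distrib f g []       = ≈-sym (identityˡ ε)
    ∏-distrib f g (x ∷ xs) = begin
      (f x ∙ g x) ∙ ∏ (λ x → f x ∙ g x) xs ≈⟨ ∙-congˡ (∏-distrib f g xs) ⟩
      (f x ∙ g x) ∙ (∏ f xs ∙ ∏ g xs)      ≈⟨ interchange (f x) (g x) (∏ f xs) (∏ g xs) ⟩
      (f x ∙ ∏ f xs) ∙ (g x ∙ ∏ g xs)      ∎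

    ∏-const : ∀ a (xs : List A) → ∏ (λ _ → a) xs ≈ length xs × a
    ∏-const a []       = ≈-refl
    ∏-const a (x ∷ xs) = ∙-congˡ (∏-const a xs)

    ∏-filter : ∀ (f : A → Carrier) (p : A → Bool) xs →
      ∏ f (filter (λ x → T? (p x)) xs) ≈ ∏ (λ x → if p x then f x else ε) xs
    ∏-filter f p []       = ≈-refl
    ∏-filter f p (x ∷ xs) with p x
    ... | true  = ∙-congˡ (∏-filter f p xs)
    ... | false = ≈-trans (∏-filter f p xs) (≈-sym (identityˡ _))

    count-× : ∀ (p : A → Bool) a xs → count p xs × a ≈ ∏ (λ x → if p x then a else ε) xs
    count-× p a xs =
      ≈-trans (≈-sym (∏-const a (filter (λ x → T? (p x)) xs))) (∏-filter (λ _ → a) p xs)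

    ∏-if-none : ∀ (q : A → Bool) a {xs} → All (λ x → ¬ T (q x)) xs →
      ∏ (λ x → if q x then a else ε) xs ≈ ε
    ∏-if-none q a []              = ≈-refl
    ∏-if-none q a {x ∷ _} (¬qx ∷ ¬qxs) with q x
    ... | true  = ⊥-elim (¬qx _)
    ... | false = ≈-trans (identityˡ _) (∏-if-none q a ¬qxs)

    module _ (q : A → Bool) (a : Carrier) (at-most-one : ∀ {x y} → T (q x) → T (q y) → x ≡ y) where

      ∏-at-most-one : ∀ {xs} → Unique xs →
        ∏ (λ x → if q x then a else ε) xs ≈ (if any q xs then a else ε)
      ∏-at-most-one []                           = ≈-refl
      ∏-at-most-one {x ∷ _} (x≢xs ∷ unique) with q x in qx
      ... | true  =
        ≈-trans (∙-congˡ (∏-if-none q a (All.map (λ x≢y qy → x≢y (at-most-one (from T-≡ qx) qy)) x≢xs)))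
                (identityʳ a)
      ... | false = ≈-trans (identityˡ _) (∏-at-most-one unique)

      ∏-exactly-one : ∀ {x xs} → Unique xs → x ∈ xs → T (q x) →
        ∏ (λ x → if q x then a else ε) xs ≈ a
      ∏-exactly-one unique x∈xs qx = ≈-trans (∏-at-most-one unique)
        (≈-reflexive (cong (λ b → if b then a else ε) (to T-≡ (any⁺ q (lose x∈xs qx)))))

  ∏-comm : ∀ {A B : Set} (h : A → B → Carrier) (xs : List A) (ys : List B) →
    ∏ (λ x → ∏ (h x) ys) xs ≈ ∏ (λ y → ∏ (λ x → h x y) xs) ys
  ∏-comm h []       ys = ≈-sym (∏-ε ys)
  ∏-comm h (x ∷ xs) ys = begin
    ∏ (h x) ys ∙ ∏ (λ x → ∏ (h x) ys) xs          ≈⟨ ∙-congˡ (∏-comm h xs ys) ⟩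
    ∏ (h x) ys ∙ ∏ (λ y → ∏ (λ x → h x y) xs) ys  ≈⟨ ∏-distrib (h x) _ ys ⟨
    ∏ (λ y → h x y ∙ ∏ (λ x → h x y) xs) ys       ∎

  ∏-image : ∀ {k n} (u : Fin k → Fin n) → Injective _≡_ _≡_ u → ∀ a →
    ∏ (λ x → if any (λ i → u i =ᶠ x) (allFin k) then a else ε) (allFin n) ≈ k × a
  ∏-image {k} {n} u inj a = begin
    ∏ (λ x → if any (λ i → u i =ᶠ x) (allFin k) then a else ε) (allFin n)
      ≈⟨ ∏-cong (λ x → ∏-at-most-one (λ i → u i =ᶠ x) a u-injective-at (allFin⁺ k)) (allFin n) ⟨
    ∏ (λ x → ∏ (λ i → if u i =ᶠ x then a else ε) (allFin k)) (allFin n)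
      ≈⟨ ∏-comm (λ x i → if u i =ᶠ x then a else ε) (allFin n) (allFin k) ⟩
    ∏ (λ i → ∏ (λ x → if u i =ᶠ x then a else ε) (allFin n)) (allFin k)
      ≈⟨ ∏-cong (λ i → ∏-exactly-one (λ x → u i =ᶠ x) a u-functional-at (allFin⁺ n)
                         (∈-allFin (u i)) (=ᶠ-refl (u i))) (allFin k) ⟩
    ∏ (λ _ → a) (allFin k)
      ≈⟨ ∏-const a (allFin k) ⟩
    length (allFin k) × a
      ≡⟨ cong (_× a) (length-allFin k) ⟩
    k × a ∎
    where
    u-injective-at : ∀ {x i j} → T (u i =ᶠ x) → T (u j =ᶠ x) → i ≡ j
    u-injective-at ui=x uj=x = inj (trans (=ᶠ⇒≡ ui=x) (sym (=ᶠ⇒≡ uj=x)))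
    u-functional-at : ∀ {i x y} → T (u i =ᶠ x) → T (u i =ᶠ y) → x ≡ y
    u-functional-at ui=x ui=y = trans (sym (=ᶠ⇒≡ ui=x)) (=ᶠ⇒≡ ui=y)

module Reachability {n : ℕ} (_~_ : Fin n → Fin n → Bool)
                    (~-sym : ∀ {x y} → T (x ~ y) → T (y ~ x)) where

  reach : ℕ → Fin n → Fin n → Bool
  reach zero    x y = x =ᶠ y
  reach (suc t) x y = (x =ᶠ y) ∨ anyᶠ (λ z → (x ~ z) ∧ reach t z y)

  infixr 5 _∷_
  data Walk≤ : ℕ → Fin n → Fin n → Set where
    []  : ∀ {t x} → Walk≤ t x x
    _∷_ : ∀ {t x y z} → T (x ~ y) → Walk≤ t y z → Walk≤ (suc t) x z

  reach⇒Walk≤ : ∀ t {x y} → T (reach t x y) → Walk≤ t x y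
  reach⇒Walk≤ zero    {x} h = subst (Walk≤ zero x) (=ᶠ⇒≡ h) []
  reach⇒Walk≤ (suc t) {x} {y} h with to (T-∨ {x =ᶠ y}) h
  ... | inj₁ x=y  = subst (Walk≤ (suc t) x) (=ᶠ⇒≡ x=y) []
  ... | inj₂ step with anyᶠ⇒∃ {p = λ z → (x ~ z) ∧ reach t z y} step
  ...   | z , x~z∧z⇝y = let x~z , z⇝y = to T-∧ x~z∧z⇝y in x~z ∷ reach⇒Walk≤ t z⇝y

  Walk≤⇒reach : ∀ {t x y} → Walk≤ t x y → T (reach t x y)
  Walk≤⇒reach {zero}  {x} []         = =ᶠ-refl x
  Walk≤⇒reach {suc t} {x} []         = from T-∨ (inj₁ (=ᶠ-refl x))
  Walk≤⇒reach {suc t} {x} {y} (x~z ∷ w) =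
    from (T-∨ {x =ᶠ y})
      (inj₂ (∃⇒anyᶠ {p = λ z → (x ~ z) ∧ reach t z y} (from T-∧ (x~z , Walk≤⇒reach w))))

  weaken : ∀ {t t′ x y} → t ≤ t′ → Walk≤ t x y → Walk≤ t′ x y
  weaken _           []        = []
  weaken (s≤s t≤t′) (x~y ∷ w) = x~y ∷ weaken t≤t′ w

  infixl 5 _∷ʳ_
  _∷ʳ_ : ∀ {t x y z} → Walk≤ t x y → T (y ~ z) → Walk≤ (suc t) x z
  []        ∷ʳ y~z = y~z ∷ []
  (x~w ∷ w) ∷ʳ y~z = x~w ∷ (w ∷ʳ y~z)

  reverse : ∀ {t x y} → Walk≤ t x y → Walk≤ t y x
  reverse []        = []
  reverse (x~z ∷ w) = reverse w ∷ʳ ~-sym x~z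

  infixr 5 _++_
  _++_ : ∀ {a b x y z} → Walk≤ a x y → Walk≤ b y z → Walk≤ (a + b) x z
  _++_ {a} {b} [] w = weaken (ℕP.m≤n+m b a) w
  (x~v ∷ v) ++ w   = x~v ∷ (v ++ w)

  Closed : ℕ → Fin n → Set
  Closed t x = ∀ {y} → Walk≤ (suc t) x y → Walk≤ t x y

  Saturated : ℕ → Fin n → Set
  Saturated t x = ∀ {m y} → Walk≤ m x y → Walk≤ t x y

  closed⇒saturated : ∀ {t x} → Closed t x → Saturated t x
  closed⇒saturated {t} {x} closed = extend []
    where
    extend : ∀ {m y z} → Walk≤ t x y → Walk≤ m y z → Walk≤ t x z
    extend v []        = v
    extend v (y~y′ ∷ w) = extend (closed (v ∷ʳ y~y′)) w

  -- Until saturation every extra step reaches a new vertex, so saturation occurs by t = n.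
  saturated-or-growing : ∀ t x → Saturated t x ⊎ t < countᶠ (reach t x)
  saturated-or-growing zero    x = inj₂ (count-pos (reach zero x) (∈-allFin x) (=ᶠ-refl x))
  saturated-or-growing (suc t) x with saturated-or-growing t x
  ... | inj₁ saturated = inj₁ (λ w → weaken (ℕP.n≤1+n t) (saturated w))
  ... | inj₂ t<count with FP.any? (λ y → T? (reach (suc t) x y) ×-dec ¬? (T? (reach t x y)))
  ...   | yes (y , y∈suc , y∉t) =
          inj₂ (ℕP.≤-trans (s≤s t<count) (count-mono-< shorter⇒longer (∈-allFin y) y∈suc y∉t))
    where
    shorter⇒longer : ∀ {y} → T (reach t x y) → T (reach (suc t) x y)
    shorter⇒longer h = Walk≤⇒reach (weaken (ℕP.n≤1+n t) (reach⇒Walk≤ t h))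
  ...   | no ∄new = inj₁ (λ w → weaken (ℕP.n≤1+n t) (closed⇒saturated closed w))
    where
    closed : Closed t x
    closed {y} w with T? (reach t x y)
    ... | yes h = reach⇒Walk≤ t h
    ... | no ¬h = ⊥-elim (∄new (y , Walk≤⇒reach w , ¬h))

  saturated : ∀ x → Saturated n x
  saturated x with saturated-or-growing n x
  ... | inj₁ saturated = saturated
  ... | inj₂ n<count = ⊥-elim (ℕP.<⇒≱ n<count count≤n)
    where
    count≤n : countᶠ (reach n x) ≤ n
    count≤n = subst (countᶠ (reach n x) ≤_) (length-allFin n)
                    (LP.length-filter (λ y → T? (reach n x y)) (allFin n))

  reach-isEquivalence : IsEquivalence (λ x y → T (reach n x y))
  reach-isEquivalence = record
    { refl  = Walk≤⇒reach {n} []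
    ; sym   = λ h → Walk≤⇒reach (reverse (reach⇒Walk≤ n h))
    ; trans = λ {x} h h′ → Walk≤⇒reach (saturated x (reach⇒Walk≤ n h ++ reach⇒Walk≤ n h′))
    }

module Partition {n : ℕ} (_≈ᶜ_ : Fin n → Fin n → Bool)
                 (equivalence : IsEquivalence (λ x y → T (x ≈ᶜ y))) where

  open IsEquivalence equivalence renaming (refl to ≈ᶜ-refl; sym to ≈ᶜ-sym; trans to ≈ᶜ-trans)

  isLeast : Fin n → Bool
  isLeast v = allᶠ λ x → not ((toℕ x <ᵇ toℕ v) ∧ (x ≈ᶜ v))

  isLeast-minimal : ∀ {r y} → T (isLeast r) → toℕ y < toℕ r → ¬ T (y ≈ᶜ r)
  isLeast-minimal {r} {y} least y<r y≈r =
    T-not⇒¬T (allᶠ⇒∀ least y) (from T-∧ (ℕP.<⇒<ᵇ y<r , y≈r))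

  ¬isLeast⇒smaller : ∀ {y} → ¬ T (isLeast y) → ∃ λ z → T ((toℕ z <ᵇ toℕ y) ∧ (z ≈ᶜ y))
  ¬isLeast⇒smaller ¬least with ¬allᶠ⇒∃ ¬least
  ... | z , h = z , ¬T-not⇒T _ h

  least-exists : ∀ x → ∃ λ r → T (isLeast r ∧ (r ≈ᶜ x))
  least-exists x = descend (suc (toℕ x)) x (ℕP.n<1+n (toℕ x)) ≈ᶜ-refl
    where
    descend : ∀ m y → toℕ y < m → T (y ≈ᶜ x) → ∃ λ r → T (isLeast r ∧ (r ≈ᶜ x))
    descend (suc m) y y<m y≈x with T? (isLeast y)
    ... | yes least = y , from T-∧ (least , y≈x)
    ... | no ¬least =
      let z , h     = ¬isLeast⇒smaller ¬least
          z<y , z≈y = to T-∧ h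
      in descend m z (ℕP.<-≤-trans (ℕP.<ᵇ⇒< _ _ z<y) (ℕP.≤-pred y<m)) (≈ᶜ-trans z≈y y≈x)

  least-unique : ∀ {x r r′} → T (isLeast r ∧ (r ≈ᶜ x)) → T (isLeast r′ ∧ (r′ ≈ᶜ x)) → r ≡ r′
  least-unique {x} {r} {r′} h h′ with to T-∧ h | to T-∧ h′ | FP.<-cmp r r′
  ... | _ , r≈x | least′ , r′≈x | tri< r<r′ _ _ =
    ⊥-elim (isLeast-minimal least′ r<r′ (≈ᶜ-trans r≈x (≈ᶜ-sym r′≈x)))
  ... | _ | _ | tri≈ _ r≡r′ _ = r≡r′
  ... | least , r≈x | _ , r′≈x | tri> _ _ r′<r =
    ⊥-elim (isLeast-minimal least r′<r (≈ᶜ-trans r′≈x (≈ᶜ-sym r≈x)))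

  module _ {c ℓ} (M : CommutativeMonoid c ℓ) where

    open CommutativeMonoid M using (Carrier; _≈_; ε; setoid) renaming (sym to ≈-sym)
    open ListProduct M
    open import Relation.Binary.Reasoning.Setoid setoid

    ∏-classes : (s : Fin n → Carrier) →
      ∏ (λ v → if isLeast v then ∏ s (filter (λ x → T? (v ≈ᶜ x)) (allFin n)) else ε) (allFin n)
        ≈ ∏ s (allFin n)
    ∏-classes s = begin
      ∏ (λ v → if isLeast v then ∏ s (filter (λ x → T? (v ≈ᶜ x)) (allFin n)) else ε) (allFin n)
        ≈⟨ ∏-cong (λ v → as-indicator (isLeast v) v) (allFin n) ⟩
      ∏ (λ v → ∏ (λ x → if isLeast v ∧ (v ≈ᶜ x) then s x else ε) (allFin n)) (allFin n)
        ≈⟨ ∏-comm (λ v x → if isLeast v ∧ (v ≈ᶜ x) then s x else ε) (allFin n) (allFin n) ⟩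
      ∏ (λ x → ∏ (λ v → if isLeast v ∧ (v ≈ᶜ x) then s x else ε) (allFin n)) (allFin n)
        ≈⟨ ∏-cong (λ x → ∏-exactly-one (λ v → isLeast v ∧ (v ≈ᶜ x)) (s x) least-unique (allFin⁺ n)
                           (∈-allFin _) (proj₂ (least-exists x))) (allFin n) ⟩
      ∏ s (allFin n) ∎
      where
      as-indicator : ∀ b v → (if b then ∏ s (filter (λ x → T? (v ≈ᶜ x)) (allFin n)) else ε)
                               ≈ ∏ (λ x → if b ∧ (v ≈ᶜ x) then s x else ε) (allFin n)
      as-indicator true  v = ∏-filter s (v ≈ᶜ_) (allFin n)
      as-indicator false v = ≈-sym (∏-ε (allFin n))

-- In the monoid of signs, m × S.- is (-1)^m.
open ListProduct SP.*-commutativeMonoid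
open ≡-Reasoning

sign-outside-image : ∀ {k n} (u : Fin k → Fin n) → Injective _≡_ _≡_ u →
  ∏ (λ x → if any (λ i → u i =ᶠ x) (allFin k) then S.+ else S.-) (allFin n) ≡ (n ∸ k) × S.-
sign-outside-image {k} {n} u inj = begin
  ∏ (λ x → if inU x then S.+ else S.-) (allFin n)
    ≡⟨ ∏-cong (λ x → flip (inU x)) (allFin n) ⟩
  ∏ (λ x → S.- *ˢ (if inU x then S.- else S.+)) (allFin n)
    ≡⟨ ∏-distrib (λ _ → S.-) (λ x → if inU x then S.- else S.+) (allFin n) ⟩
  ∏ (λ _ → S.-) (allFin n) *ˢ ∏ (λ x → if inU x then S.- else S.+) (allFin n)
    ≡⟨ cong₂ _*ˢ_ (trans (∏-const S.- (allFin n)) (cong (_× S.-) (length-allFin n)))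
                  (∏-image u inj S.-) ⟩
  n × S.- *ˢ k × S.-
    ≡⟨ cong (λ m → m × S.- *ˢ k × S.-) (ℕP.m∸n+n≡m (FP.injective⇒≤ inj)) ⟨
  (n ∸ k + k) × S.- *ˢ k × S.-
    ≡⟨ cong (_*ˢ k × S.-) (×-homo-+ S.- (n ∸ k) k) ⟩
  (n ∸ k) × S.- *ˢ k × S.- *ˢ k × S.-
    ≡⟨ SP.*-assoc ((n ∸ k) × S.-) (k × S.-) (k × S.-) ⟩
  (n ∸ k) × S.- *ˢ (k × S.- *ˢ k × S.-)
    ≡⟨ cong ((n ∸ k) × S.- *ˢ_) (SP.s*s≡+ (k × S.-)) ⟩
  (n ∸ k) × S.- *ˢ S.+
    ≡⟨ SP.*-identityʳ ((n ∸ k) × S.-) ⟩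
  (n ∸ k) × S.- ∎
  where
  inU : Fin n → Bool
  inU x = any (λ i → u i =ᶠ x) (allFin k)
  flip : ∀ b → (if b then S.+ else S.-) ≡ S.- *ˢ (if b then S.- else S.+)
  flip true  = refl
  flip false = refl

module _ (G : OrientedHypergraph) {k : ℕ} (u w : Fin k → Fin (nV G)) (c : Assignment G u w) where

  private
    V : List (Fin (nV G))
    V = allFin (nV G)

  linked-sym : ∀ {x y} → T (linked G u w c x y) → T (linked G u w c y x)
  linked-sym {x} {y} = subst T (∨-comm (stepEdge G u w c x y) (stepEdge G u w c y x))

  open Reachability (linked G u w c) linked-sym using (reach; reach-isEquivalence)

  walk≡reach : ∀ t x y → walk G u w c t x y ≡ reach t x y
  walk≡reach zero    x y = refl
  walk≡reach (suc t) x y =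
    cong (λ b → (x =ᶠ y) ∨ or b)
      (LP.map-cong (λ z → cong (linked G u w c x z ∧_) (walk≡reach t z y)) V)

  connected-isEquivalence : IsEquivalence (λ x y → T (connected G u w c x y))
  connected-isEquivalence = record
    { refl  = from-reach R.refl
    ; sym   = λ h → from-reach (R.sym (to-reach h))
    ; trans = λ h h′ → from-reach (R.trans (to-reach h) (to-reach h′))
    }
    where
    module R = IsEquivalence reach-isEquivalence
    to-reach : ∀ {x y} → T (connected G u w c x y) → T (reach (nV G) x y)
    to-reach {x} {y} = subst T (walk≡reach (nV G) x y)
    from-reach : ∀ {x y} → T (reach (nV G) x y) → T (connected G u w c x y)
    from-reach {x} {y} = subst T (sym (walk≡reach (nV G) x y))

  open Partition (connected G u w c) connected-isEquivalence using (∏-classes)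

  nc-sign : nc G u w c × S.- ≡ ∏ (stepSign G u w c) V
  nc-sign = begin
    nc G u w c × S.-
      ≡⟨ count-× (λ v → rep v ∧ isNegativeSign G u w (component v)) S.- V ⟩
    ∏ (λ v → if rep v ∧ isNegativeSign G u w (component v) then S.- else S.+) V
      ≡⟨ ∏-cong (λ v → negative-indicator (rep v) (component v)) V ⟩
    ∏ (λ v → if rep v then component v else S.+) V
      ≡⟨ ∏-classes SP.*-commutativeMonoid (stepSign G u w c) ⟩
    ∏ (stepSign G u w c) V ∎
    where
    rep : Fin (nV G) → Bool
    rep = isRepresentative G u w c
    component : Fin (nV G) → Sign
    component = componentSign G u w c
    negative-indicator : ∀ b σ →
      (if b ∧ isNegativeSign G u w σ then S.- else S.+) ≡ (if b then σ else S.+)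
    negative-indicator false _   = refl
    negative-indicator true  S.- = refl
    negative-indicator true  S.+ = refl

  -- stepsOK and bs test each vertex with a function local to Defs, hence out of scope;
  -- unifying with the unfolded definitions recovers it.
  stepOKAt : Fin (nV G) → Bool
  stepOKAt = proj₁ unfolded
    where
    unfolded : Σ (Fin (nV G) → Bool) λ p → stepsOK G u w c ≡ allᶠ p
    unfolded = _ , refl

  isBackstepAt : Fin (nV G) → Bool
  isBackstepAt = proj₁ unfolded
    where
    unfolded : Σ (Fin (nV G) → Bool) λ p → bs G u w c ≡ countᶠ p
    unfolded = _ , refl

  vertex-sign : AllAdjacenciesNegative G → ∀ x → T (stepOKAt x) →
    (if isBackstepAt x then S.- else S.+) *ˢ stepSign G u w c x
      ≡ (if is-just (indexInU G u w x) then S.+ else S.-)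
  vertex-sign negative x ok with indexInU G u w x | Vec.lookup c x
  ... | just _  | nothing = refl
  ... | just _  | just _  = ⊥-elim ok
  ... | nothing | nothing = ⊥-elim ok
  ... | nothing | just (i , j) with i ≟ j
  ...   | yes _   = refl
  ...   | no i≢j = negative i j i≢j (=ᶠ⇒≡ (proj₂ (to T-∧ ok)))

  sign-parity : AllAdjacenciesNegative G → Injective _≡_ _≡_ u → T (stepsOK G u w c) →
    (nc G u w c + bs G u w c) × S.- ≡ (nV G ∸ k) × S.-
  sign-parity negative inj ok = begin
    (nc G u w c + bs G u w c) × S.-
      ≡⟨ ×-homo-+ S.- (nc G u w c) (bs G u w c) ⟩
    nc G u w c × S.- *ˢ bs G u w c × S.-
      ≡⟨ cong₂ _*ˢ_ nc-sign (count-× isBackstepAt S.- V) ⟩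
    ∏ (stepSign G u w c) V *ˢ ∏ backstepSign V
      ≡⟨ SP.*-comm (∏ (stepSign G u w c) V) (∏ backstepSign V) ⟩
    ∏ backstepSign V *ˢ ∏ (stepSign G u w c) V
      ≡⟨ ∏-distrib backstepSign (stepSign G u w c) V ⟨
    ∏ (λ x → backstepSign x *ˢ stepSign G u w c x) V
      ≡⟨ ∏-cong (λ x → vertex-sign negative x (allᶠ⇒∀ ok x)) V ⟩
    ∏ (λ x → if is-just (indexInU G u w x) then S.+ else S.-) V
      ≡⟨ ∏-cong (λ x → cong (λ b → if b then S.+ else S.-)
                            (is-just-findᵇ (λ i → u i =ᶠ x) (allFin k))) V ⟩
    ∏ (λ x → if any (λ i → u i =ᶠ x) (allFin k) then S.+ else S.-) V
      ≡⟨ sign-outside-image u inj ⟩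
    (nV G ∸ k) × S.- ∎
    where
    backstepSign : Fin (nV G) → Sign
    backstepSign x = if isBackstepAt x then S.- else S.+

-1ℤ^≡◃ : ∀ m → -1ℤ ^ m ≡ (m × S.-) ◃ 1
-1ℤ^≡◃ zero    = refl
-1ℤ^≡◃ (suc m) = trans (cong (-1ℤ *_) (-1ℤ^≡◃ m)) (negate (m × S.-))
  where
  negate : ∀ s → -1ℤ * (s ◃ 1) ≡ (S.- *ˢ s) ◃ 1
  negate S.+ = refl
  negate S.- = refl

sumℤ-const : ∀ {A : Set} (s : ℤ) (xs : List A) → sumℤ (map (λ _ → s) xs) ≡ s * + length xs
sumℤ-const s []       = sym (ℤP.*-zeroʳ s)
sumℤ-const s (x ∷ xs) = trans (cong (s +ℤ_) (sumℤ-const s xs)) (sym (ℤP.*-suc s (+ length xs)))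

sumℤ-filter-const : ∀ {A : Set} (P : A → Bool) (f : A → ℤ) (s : ℤ) →
  (∀ x → T (P x) → f x ≡ s) → ∀ xs →
  sumℤ (map f (filter (λ x → T? (P x)) xs)) ≡ s * + length (filter (λ x → T? (P x)) xs)
sumℤ-filter-const P f s f≡s xs =
  trans (cong sumℤ (LP.map-cong-local (All.map (f≡s _) (all-filter (λ x → T? (P x)) xs))))
        (sumℤ-const s (filter (λ x → T? (P x)) xs))

theorem5p2 : (G : OrientedHypergraph) → AllAdjacenciesNegative G →
    (k : ℕ) (u w : Fin k → Fin (nV G)) → Injective _≡_ _≡_ u →
    sumℤ (map (sgnP G u w) (contributors G u w))
      ≡ (-1ℤ ^ (nV G ∸ k)) * (+ length (contributors G u w))
theorem5p2 G negative k u w inj =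
  sumℤ-filter-const (isContributor G u w) (sgnP G u w) (-1ℤ ^ (nV G ∸ k)) constant-sign
    (allVecs (nothing ∷ map just (cartesianProduct (allFin (nI G)) (allFin (nI G)))) (nV G))
  where
  constant-sign : ∀ c → T (isContributor G u w c) → sgnP G u w c ≡ -1ℤ ^ (nV G ∸ k)
  constant-sign c contributor = begin
    -1ℤ ^ (nc G u w c + bs G u w c)       ≡⟨ -1ℤ^≡◃ (nc G u w c + bs G u w c) ⟩
    ((nc G u w c + bs G u w c) × S.-) ◃ 1 ≡⟨ cong (_◃ 1) (sign-parity G u w c negative inj stepsOK-c) ⟩
    ((nV G ∸ k) × S.-) ◃ 1                ≡⟨ -1ℤ^≡◃ (nV G ∸ k) ⟨
    -1ℤ ^ (nV G ∸ k)                      ∎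
    where
    stepsOK-c : T (stepsOK G u w c)
    stepsOK-c = proj₁ (to T-∧ contributor)
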